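{- For an integer $k\geq 1$, let $T_k$ be the tournament of order $n=3k$ obtained from a collection $t_1,\ldots,t_k$ of vertex-disjoint directed triangles, with arcs going from all vertices of $t_i$ to all vertices of $t_j$ whenever $i<j$. Then $\gamma_L(T_k)=\lceil n/2\rceil$.
   Context: A tournament has a unique arc between any pair of vertices. A dominating set of a digraph is a set $D$ such that every vertex not in $D$ has an in-neighbour in $D$; it is locating-dominating if moreover every vertex not in $D$ has a distinct set of in-neighbours in $D$. $\gamma_L$ is the minimum size of a locating-dominating set. -}

module Defs where

open import Data.Nat using (ℕ; _+_; _*_; _<_; _≡ᵇ_; _<ᵇ_; ⌈_/2⌉; _≤_)
open import Data.Nat.DivMod using (_/_; _%_)
open import Data.Bool using (Bool; true; false; _∧_; _∨_)
open import Data.Fin using (Fin; toℕ)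
open import Data.Fin.Subset using (Subset; _∈_; _∉_; ∣_∣)
open import Data.Vec using (tabulate; lookup)
open import Data.Product using (_×_; Σ-syntax)
open import Relation.Binary.PropositionalEquality using (_≡_; _≢_)

Digraph : ℕ → Set
Digraph n = Fin n → Fin n → Bool

inNbrsIn : {n : ℕ} → Digraph n → Subset n → Fin n → Subset n
inNbrsIn G D u = tabulate (λ d → lookup D d ∧ G d u)

IsDominating : {n : ℕ} → Digraph n → Subset n → Set
IsDominating {n} G D = (u : Fin n) → u ∉ D → Σ[ d ∈ Fin n ] (d ∈ D × G d u ≡ true)

IsLocatingDominating : {n : ℕ} → Digraph n → Subset n → Set
IsLocatingDominating {n} G D =
  IsDominating G D ×
  ((u v : Fin n) → u ∉ D → v ∉ D → u ≢ v → inNbrsIn G D u ≢ inNbrsIn G D v)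

LocDomNumberIs : {n : ℕ} → Digraph n → ℕ → Set
LocDomNumberIs {n} G m =
  (Σ[ D ∈ Subset n ] (IsLocatingDominating G D × ∣ D ∣ ≡ m)) ×
  ((D : Subset n) → IsLocatingDominating G D → m ≤ ∣ D ∣)

-- The tournament T_k on Fin (3 * k): vertex v lies in triangle t_(v / 3),
-- at position v % 3 in it.
T : (k : ℕ) → Digraph (3 * k)
T k u v =
  (toℕ u / 3 <ᵇ toℕ v / 3) ∨
  ((toℕ u / 3 ≡ᵇ toℕ v / 3) ∧ (toℕ v % 3 ≡ᵇ ((toℕ u % 3) + 1) % 3))

-- Let s_i be the number of vertices that a locating-dominating set D has in the
-- triangle t_i.  If t_i misses D, two of its vertices have the same in-neighbours
-- in D, namely D ∩ (t_0 ∪ … ∪ t_(i-1)); if t_0 meets D in a single vertex, the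
-- predecessor of that vertex in t_0 is undominated; and if t_i and t_(i+1) each meet
-- D in a single vertex, the successor of the first and the predecessor of the second
-- both have in-neighbourhood D ∩ (t_0 ∪ … ∪ t_i).  So s_i ≥ 1, s_0 ≥ 2 and
-- s_i + s_(i+1) ≥ 3, whence |D| ≥ ⌈3k/2⌉.  Conversely, the vertices at position 0
-- of every triangle together with those at position 1 of the even-indexed triangles
-- form a locating-dominating set of that size.

module Submission where

open import Defs
open import Data.Nat.Base
  using (ℕ; zero; suc; _+_; _*_; _≤_; _<_; _<ᵇ_; _≡ᵇ_; ⌊_/2⌋; ⌈_/2⌉; z≤n; s≤s; z<s; s<s; NonZero)
open import Data.Nat.Properties
open import Data.Nat.DivMod
open import Data.Nat.Divisibility using (divides-refl)
open import Data.Bool using (Bool; true; false; _∧_; _∨_; not; if_then_else_)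
open import Data.Bool.Properties using (∨-identityʳ)
open import Data.Fin as Fin using (Fin; toℕ; fromℕ<)
open import Data.Fin.Properties using (toℕ-fromℕ<; toℕ-injective; toℕ<n)
open import Data.Fin.Subset using (Subset; _∈_; _∉_; ∣_∣)
open import Data.Vec using ([]; _∷_; tabulate; lookup)
open import Data.Vec.Properties using (lookup∘tabulate; tabulate-cong; []=⇒lookup; lookup⇒[]=)
open import Data.Product using (_×_; _,_; proj₁; proj₂; ∃-syntax)
open import Data.Empty using (⊥)
open import Data.Sum using (inj₁; inj₂)
open import Function using (_∘_; flip)
open import Relation.Nullary using (yes; no; contradiction)
open import Relation.Nullary.Decidable using (dec-true; dec-false)
open import Relation.Binary using (tri<; tri≈; tri>)
open import Relation.Binary.PropositionalEquality

inNbrsIn-cong : ∀ {n} (G : Digraph n) (D : Subset n) {u v} →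
                (∀ d → d ∈ D → G d u ≡ G d v) → inNbrsIn G D u ≡ inNbrsIn G D v
inNbrsIn-cong G D same = tabulate-cong agree
  where
  agree : ∀ d → lookup D d ∧ G d _ ≡ lookup D d ∧ G d _
  agree d with lookup D d in d∈D
  ... | true  = same d (lookup⇒[]= d D d∈D)
  ... | false = refl

inNbrsIn-separates : ∀ {n} (G : Digraph n) (D : Subset n) {u v d} →
                     d ∈ D → G d u ≡ true → G d v ≡ false → inNbrsIn G D u ≢ inNbrsIn G D v
inNbrsIn-separates G D {u} {v} {d} d∈D du dv eq = contradiction (begin
  true                        ≡⟨ sym (cong₂ _∧_ ([]=⇒lookup d∈D) du) ⟩
  lookup D d ∧ G d u          ≡⟨ sym (lookup∘tabulate _ d) ⟩
  lookup (inNbrsIn G D u) d   ≡⟨ cong (λ N → lookup N d) eq ⟩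
  lookup (inNbrsIn G D v) d   ≡⟨ lookup∘tabulate _ d ⟩
  lookup D d ∧ G d v          ≡⟨ cong₂ _∧_ ([]=⇒lookup d∈D) dv ⟩
  false                       ∎) λ ()
  where open ≡-Reasoning

count : (ℕ → Bool) → ℕ → ℕ
count f zero    = 0
count f (suc n) = (if f 0 then 1 else 0) + count (λ a → f (suc a)) n

∑ : (ℕ → ℕ) → ℕ → ℕ
∑ s zero    = 0
∑ s (suc k) = s 0 + ∑ (λ i → s (suc i)) k

count-cong : ∀ n {f g} → (∀ a → a < n → f a ≡ g a) → count f n ≡ count g n
count-cong zero    f≗g = refl
count-cong (suc n) f≗g =
  cong₂ (λ b c → (if b then 1 else 0) + c) (f≗g 0 z<s) (count-cong n (λ a a<n → f≗g (suc a) (s<s a<n)))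

∑-cong : ∀ k {s t} → (∀ i → s i ≡ t i) → ∑ s k ≡ ∑ t k
∑-cong zero    s≗t = refl
∑-cong (suc k) s≗t = cong₂ _+_ (s≗t 0) (∑-cong k (λ i → s≗t (suc i)))

count-+ : ∀ m n f → count f (m + n) ≡ count f m + count (λ a → f (m + a)) n
count-+ zero    n f = refl
count-+ (suc m) n f = trans (cong ((if f 0 then 1 else 0) +_) (count-+ m n (λ a → f (suc a))))
                            (sym (+-assoc (if f 0 then 1 else 0) _ _))

count-blocks : ∀ k n f → count f (k * n) ≡ ∑ (λ i → count (λ r → f (i * n + r)) n) k
count-blocks zero    n f = refl
count-blocks (suc k) n f = begin
  count f (n + k * n)                                           ≡⟨ count-+ n (k * n) f ⟩
  count f n + count (λ a → f (n + a)) (k * n)                   ≡⟨ cong (count f n +_) (count-blocks k n _) ⟩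
  count f n + ∑ (λ i → count (λ r → f (n + (i * n + r))) n) k   ≡⟨ cong (count f n +_) (∑-cong k shift) ⟩
  count f n + ∑ (λ i → count (λ r → f (suc i * n + r)) n) k     ∎
  where
  open ≡-Reasoning
  shift : ∀ i → count (λ r → f (n + (i * n + r))) n ≡ count (λ r → f (suc i * n + r)) n
  shift i = count-cong n (λ r _ → cong f (sym (+-assoc n (i * n) r)))

count≡0 : ∀ n {f} → count f n ≡ 0 → ∀ a → a < n → f a ≡ false
count≡0 (suc n) {f} c a a<n with f 0 in f0
count≡0 (suc n) {f} () a a<n | true
count≡0 (suc n) {f} c zero    _         | false = f0
count≡0 (suc n) {f} c (suc a) (s<s a<n) | false = count≡0 n c a a<n

count≡1 : ∀ n {f} → count f n ≡ 1 → ∃[ p ] (p < n × f p ≡ true × (∀ a → f a ≡ true → a < n → a ≡ p))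
count≡1 (suc n) {f} c with f 0 in f0
... | true  = 0 , z<s , f0 , unique
  where
  unique : ∀ a → f a ≡ true → a < suc n → a ≡ 0
  unique zero    _   _         = refl
  unique (suc a) fa (s<s a<n) = contradiction (trans (sym fa) (count≡0 n (suc-injective c) a a<n)) λ ()
... | false with count≡1 n c
...   | p , p<n , fp , unique = suc p , s<s p<n , fp , unique′
  where
  unique′ : ∀ a → f a ≡ true → a < suc n → a ≡ suc p
  unique′ zero    fa _         = contradiction (trans (sym fa) f0) λ ()
  unique′ (suc a) fa (s<s a<n) = cong suc (unique a fa a<n)

memberAt : ∀ {n} → Subset n → ℕ → Bool
memberAt []      a       = false
memberAt (x ∷ p) zero    = x
memberAt (x ∷ p) (suc a) = memberAt p a

lookup≡memberAt : ∀ {n} (p : Subset n) i → lookup p i ≡ memberAt p (toℕ i)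
lookup≡memberAt (x ∷ p) Fin.zero    = refl
lookup≡memberAt (x ∷ p) (Fin.suc i) = lookup≡memberAt p i

∣p∣≡count : ∀ {n} (p : Subset n) → ∣ p ∣ ≡ count (memberAt p) n
∣p∣≡count []          = refl
∣p∣≡count (true ∷ p)  = cong suc (∣p∣≡count p)
∣p∣≡count (false ∷ p) = ∣p∣≡count p

∣tabulate∣≡count : ∀ n (f : ℕ → Bool) → ∣ tabulate {n = n} (λ i → f (toℕ i)) ∣ ≡ count f n
∣tabulate∣≡count zero    f = refl
∣tabulate∣≡count (suc n) f with f 0
... | true  = cong suc (∣tabulate∣≡count n (λ a → f (suc a)))
... | false = ∣tabulate∣≡count n (λ a → f (suc a))

⌊3k/2⌋≤∑ : ∀ k (s : ℕ → ℕ) → (∀ i → i < k → 1 ≤ s i) → (∀ i → suc i < k → 3 ≤ s i + s (suc i)) →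
           ⌊ k * 3 /2⌋ ≤ ∑ s k
⌊3k/2⌋≤∑ zero          s positive pairs = z≤n
⌊3k/2⌋≤∑ (suc zero)    s positive pairs = subst (1 ≤_) (sym (+-identityʳ (s 0))) (positive 0 z<s)
⌊3k/2⌋≤∑ (suc (suc k)) s positive pairs =
  subst (3 + ⌊ k * 3 /2⌋ ≤_) (+-assoc (s 0) (s 1) _)
    (+-mono-≤ (pairs 0 (s<s z<s))
              (⌊3k/2⌋≤∑ k (λ i → s (suc (suc i))) (λ i i<k → positive _ (s<s (s<s i<k)))
                                                  (λ i i<k → pairs _ (s<s (s<s i<k)))))

⌈3k/2⌉≤∑ : ∀ k (s : ℕ → ℕ) → (0 < k → 2 ≤ s 0) → (∀ i → i < k → 1 ≤ s i) →
           (∀ i → suc i < k → 3 ≤ s i + s (suc i)) → ⌈ k * 3 /2⌉ ≤ ∑ s k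
⌈3k/2⌉≤∑ zero    s first positive pairs = z≤n
⌈3k/2⌉≤∑ (suc k) s first positive pairs =
  +-mono-≤ (first z<s) (⌊3k/2⌋≤∑ k (λ i → s (suc i)) (λ i i<k → positive _ (s<s i<k))
                                                     (λ i i<k → pairs _ (s<s i<k)))

[q*n+r]/n≡q : ∀ q {n r} .{{_ : NonZero n}} → r < n → (q * n + r) / n ≡ q
[q*n+r]/n≡q q {n} {r} r<n = begin
  (q * n + r) / n     ≡⟨ +-distrib-/-∣ˡ r (divides-refl q) ⟩
  q * n / n + r / n   ≡⟨ cong₂ _+_ (m*n/n≡m q n) (m<n⇒m/n≡0 r<n) ⟩
  q + 0               ≡⟨ +-identityʳ q ⟩
  q                   ∎
  where open ≡-Reasoning

[q*n+r]%n≡r : ∀ q {n r} .{{_ : NonZero n}} → r < n → (q * n + r) % n ≡ r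
[q*n+r]%n≡r q {n} {r} r<n = trans (%-remove-+ˡ r (divides-refl q)) (m<n⇒m%n≡m r<n)

q*n+r<k*n : ∀ {q k n r} → q < k → r < n → q * n + r < k * n
q*n+r<k*n {q} {k} {n} {r} q<k r<n = begin-strict
  q * n + r   <⟨ +-monoʳ-< (q * n) r<n ⟩
  q * n + n   ≡⟨ +-comm (q * n) n ⟩
  suc q * n   ≤⟨ *-monoˡ-≤ n q<k ⟩
  k * n       ∎
  where open ≤-Reasoning

module Coordinates (k : ℕ) where

  triangle : Fin (3 * k) → ℕ
  triangle u = toℕ u / 3

  pos : Fin (3 * k) → ℕ
  pos u = toℕ u % 3

  pos-follows : Fin (3 * k) → Fin (3 * k) → Bool
  pos-follows d u = pos u ≡ᵇ (pos d + 1) % 3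

  toℕ≡triangle*3+pos : ∀ u → toℕ u ≡ triangle u * 3 + pos u
  toℕ≡triangle*3+pos u = trans (m≡m%n+[m/n]*n (toℕ u) 3) (+-comm (pos u) _)

  triangle<k : ∀ u → triangle u < k
  triangle<k u = m<n*o⇒m/o<n (subst (toℕ u <_) (*-comm 3 k) (toℕ<n u))

  pos<3 : ∀ u → pos u < 3
  pos<3 u = m%n<n (toℕ u) 3

  coordinates-injective : ∀ {u v} → triangle u ≡ triangle v → pos u ≡ pos v → u ≡ v
  coordinates-injective {u} {v} b≡ p≡ =
    toℕ-injective (begin
      toℕ u                    ≡⟨ toℕ≡triangle*3+pos u ⟩
      triangle u * 3 + pos u   ≡⟨ cong₂ (λ q r → q * 3 + r) b≡ p≡ ⟩
      triangle v * 3 + pos v   ≡⟨ toℕ≡triangle*3+pos v ⟨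
      toℕ v                    ∎)
    where open ≡-Reasoning

  index<3k : ∀ {q r} → q < k → r < 3 → q * 3 + r < 3 * k
  index<3k {q} {r} q<k r<3 = subst (q * 3 + r <_) (*-comm k 3) (q*n+r<k*n q<k r<3)

  vertex : ∀ q → q < k → ∀ r → r < 3 → Fin (3 * k)
  vertex q q<k r r<3 = fromℕ< (index<3k q<k r<3)

  triangle-vertex : ∀ q q<k r r<3 → triangle (vertex q q<k r r<3) ≡ q
  triangle-vertex q q<k r r<3 = trans (cong (_/ 3) (toℕ-fromℕ< (index<3k q<k r<3))) ([q*n+r]/n≡q q r<3)

  pos-vertex : ∀ q q<k r r<3 → pos (vertex q q<k r r<3) ≡ r
  pos-vertex q q<k r r<3 = trans (cong (_% 3) (toℕ-fromℕ< (index<3k q<k r<3))) ([q*n+r]%n≡r q r<3)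

  -- dec-true/dec-false apply because does (m ≟ n) and does (m <? n) compute to the
  -- Boolean tests m ≡ᵇ n and m <ᵇ n used in the definition of T.
  T-outside-triangle : ∀ d u → triangle d ≢ triangle u → T k d u ≡ (triangle d <ᵇ triangle u)
  T-outside-triangle d u b≢ =
    trans (cong (λ b → (triangle d <ᵇ triangle u) ∨ (b ∧ pos-follows d u))
                (dec-false (triangle d ≟ triangle u) b≢))
          (∨-identityʳ _)

  T-up : ∀ d u → triangle d < triangle u → T k d u ≡ true
  T-up d u b< =
    cong (_∨ ((triangle d ≡ᵇ triangle u) ∧ pos-follows d u)) (dec-true (triangle d <? triangle u) b<)

  T-down : ∀ d u → triangle u < triangle d → T k d u ≡ false
  T-down d u b> = trans (T-outside-triangle d u (>⇒≢ b>)) (dec-false (triangle d <? triangle u) (<-asym b>))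

  T-within-triangle : ∀ d u → triangle d ≡ triangle u → T k d u ≡ pos-follows d u
  T-within-triangle d u b≡ =
    cong₂ (λ a b → a ∨ (b ∧ pos-follows d u))
          (dec-false (triangle d <? triangle u) (<-irrefl b≡)) (dec-true (triangle d ≟ triangle u) b≡)

  T-within-triangle-at : ∀ d u {p r} → triangle d ≡ triangle u → pos d ≡ p → pos u ≡ r →
                         T k d u ≡ (r ≡ᵇ (p + 1) % 3)
  T-within-triangle-at d u b≡ pd pu = trans (T-within-triangle d u b≡) (cong₂ (λ r p → r ≡ᵇ (p + 1) % 3) pu pd)

  T≡true⇒triangle≤ : ∀ d u → T k d u ≡ true → triangle d ≤ triangle u
  T≡true⇒triangle≤ d u d→u = ≮⇒≥ (λ b> → contradiction (trans (sym d→u) (T-down d u b>)) λ ())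

rotations-distinct : ∀ {p} → p < 3 → (p + 1) % 3 ≢ p × (p + 2) % 3 ≢ p × (p + 2) % 3 ≢ (p + 1) % 3
rotations-distinct {0} _ = (λ ()) , (λ ()) , (λ ())
rotations-distinct {1} _ = (λ ()) , (λ ()) , (λ ())
rotations-distinct {2} _ = (λ ()) , (λ ()) , (λ ())
rotations-distinct {suc (suc (suc _))} (s≤s (s≤s (s≤s ())))

module LowerBound (k : ℕ) (D : Subset (3 * k)) (D-ld : IsLocatingDominating (T k) D) where

  open Coordinates k

  member : ℕ → ℕ → Bool
  member q r = memberAt D (q * 3 + r)

  size : ℕ → ℕ
  size q = count (member q) 3

  ∣D∣≡∑size : ∣ D ∣ ≡ ∑ size k
  ∣D∣≡∑size = begin
    ∣ D ∣                        ≡⟨ ∣p∣≡count D ⟩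
    count (memberAt D) (3 * k)   ≡⟨ cong (count (memberAt D)) (*-comm 3 k) ⟩
    count (memberAt D) (k * 3)   ≡⟨ count-blocks k 3 (memberAt D) ⟩
    ∑ size k                     ∎
    where open ≡-Reasoning

  member-of : ∀ {d q} → d ∈ D → triangle d ≡ q → member q (pos d) ≡ true
  member-of {d} d∈D refl = begin
    member (triangle d) (pos d)   ≡⟨ cong (memberAt D) (sym (toℕ≡triangle*3+pos d)) ⟩
    memberAt D (toℕ d)            ≡⟨ sym (lookup≡memberAt D d) ⟩
    lookup D d                    ≡⟨ []=⇒lookup d∈D ⟩
    true                          ∎
    where open ≡-Reasoning

  outsider : ∀ q → q < k → ∀ r → r < 3 → member q r ≢ true → ∃[ u ] (u ∉ D × triangle u ≡ q × pos u ≡ r)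
  outsider q q<k r r<3 vacant = u , u∉D , triangle-vertex q q<k r r<3 , pos-vertex q q<k r r<3
    where
    u = vertex q q<k r r<3
    u∉D : u ∉ D
    u∉D u∈D = vacant (subst (λ r → member q r ≡ true) (pos-vertex q q<k r r<3)
                            (member-of u∈D (triangle-vertex q q<k r r<3)))

  indistinguishable : ∀ {u v} → u ∉ D → v ∉ D → u ≢ v → (∀ d → d ∈ D → T k d u ≡ T k d v) → ⊥
  indistinguishable {u} {v} u∉D v∉D u≢v same = proj₂ D-ld u v u∉D v∉D u≢v (inNbrsIn-cong (T k) D {u} {v} same)

  vacant-of-empty : ∀ q → size q ≡ 0 → ∀ r → r < 3 → member q r ≢ true
  vacant-of-empty q size≡0 r r<3 m = contradiction (trans (sym m) (count≡0 3 {member q} size≡0 r r<3)) λ ()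

  sole-member : ∀ q → size q ≡ 1 →
                ∃[ p ] (p < 3 × (∀ r → r < 3 → r ≢ p → member q r ≢ true)
                              × (∀ {d} → d ∈ D → triangle d ≡ q → pos d ≡ p))
  sole-member q size≡1 with count≡1 3 {member q} size≡1
  ... | p , p<3 , _ , unique =
    p , p<3 , (λ r r<3 r≢p m → r≢p (unique r m r<3))
      , λ {d} d∈D bd → unique (pos d) (member-of d∈D bd) (pos<3 d)

  triangle-nonempty : ∀ q → q < k → size q ≢ 0
  triangle-nonempty q q<k size≡0
    with outsider q q<k 0 z<s (vacant-of-empty q size≡0 0 z<s)
       | outsider q q<k 1 (s<s z<s) (vacant-of-empty q size≡0 1 (s<s z<s))
  ... | u , u∉D , bu , pu | v , v∉D , bv , pv =
    indistinguishable u∉D v∉D (λ u≡v → contradiction (trans (sym pu) (trans (cong pos u≡v) pv)) λ ()) same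
    where
    same : ∀ d → d ∈ D → T k d u ≡ T k d v
    same d d∈D = begin
      T k d u                      ≡⟨ T-outside-triangle d u (other-triangle ∘ flip trans bu) ⟩
      (triangle d <ᵇ triangle u)   ≡⟨ cong (triangle d <ᵇ_) (trans bu (sym bv)) ⟩
      (triangle d <ᵇ triangle v)   ≡⟨ sym (T-outside-triangle d v (other-triangle ∘ flip trans bv)) ⟩
      T k d v                      ∎
      where
      open ≡-Reasoning
      other-triangle : triangle d ≢ q
      other-triangle bd = vacant-of-empty q size≡0 (pos d) (pos<3 d) (member-of d∈D bd)

  first-triangle-not-singleton : 0 < k → size 0 ≢ 1
  first-triangle-not-singleton 0<k size≡1 with sole-member 0 size≡1
  ... | p , p<3 , vacant , pos≡p with rotations-distinct p<3
  ... | _ , p+2≢p , p+2≢p+1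
    with outsider 0 0<k ((p + 2) % 3) (m%n<n (p + 2) 3) (vacant _ (m%n<n (p + 2) 3) p+2≢p)
  ... | u , u∉D , bu , pu with proj₁ D-ld u u∉D
  ... | d , d∈D , d→u = contradiction (begin
    true                           ≡⟨ sym d→u ⟩
    T k d u                        ≡⟨ T-within-triangle-at d u (trans bd≡0 (sym bu)) (pos≡p d∈D bd≡0) pu ⟩
    ((p + 2) % 3 ≡ᵇ (p + 1) % 3)   ≡⟨ dec-false ((p + 2) % 3 ≟ (p + 1) % 3) p+2≢p+1 ⟩
    false                          ∎) λ ()
    where
    open ≡-Reasoning
    bd≡0 : triangle d ≡ 0
    bd≡0 = n≤0⇒n≡0 (subst (triangle d ≤_) bu (T≡true⇒triangle≤ d u d→u))

  no-adjacent-singletons : ∀ q → suc q < k → size q ≡ 1 → size (suc q) ≢ 1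
  no-adjacent-singletons q sq<k size≡1 size′≡1
    with sole-member q size≡1 | sole-member (suc q) size′≡1
  ... | p , p<3 , vacant , pos≡p | p′ , p′<3 , vacant′ , pos≡p′
    with rotations-distinct p<3 | rotations-distinct p′<3
  ... | p+1≢p , _ , _ | _ , p′+2≢p′ , p′+2≢p′+1
    with outsider q (<-trans (n<1+n q) sq<k) ((p + 1) % 3) (m%n<n (p + 1) 3) (vacant _ (m%n<n (p + 1) 3) p+1≢p)
       | outsider (suc q) sq<k ((p′ + 2) % 3) (m%n<n (p′ + 2) 3) (vacant′ _ (m%n<n (p′ + 2) 3) p′+2≢p′)
  ... | u , u∉D , bu , pu | v , v∉D , bv , pv =
    indistinguishable u∉D v∉D (λ u≡v → 1+n≢n (trans (sym bv′) (cong triangle (sym u≡v)))) same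
    where
    bv′ : triangle v ≡ suc (triangle u)
    bv′ = trans bv (cong suc (sym bu))
    same : ∀ d → d ∈ D → T k d u ≡ T k d v
    same d d∈D with <-cmp (triangle d) (triangle u)
    ... | tri< b<bu _ _ =
      trans (T-up d u b<bu) (sym (T-up d v (subst (triangle d <_) (sym bv′) (m<n⇒m<1+n b<bu))))
    ... | tri≈ _ b≡bu _ = begin
      T k d u                        ≡⟨ T-within-triangle-at d u b≡bu (pos≡p d∈D (trans b≡bu bu)) pu ⟩
      ((p + 1) % 3 ≡ᵇ (p + 1) % 3)   ≡⟨ dec-true ((p + 1) % 3 ≟ (p + 1) % 3) refl ⟩
      true                           ≡⟨ sym (T-up d v (subst₂ _<_ (sym b≡bu) (sym bv′) (n<1+n (triangle u)))) ⟩
      T k d v                        ∎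
      where open ≡-Reasoning
    ... | tri> _ _ bu<b with m≤n⇒m<n∨m≡n bu<b
    ...   | inj₁ bv<b = trans (T-down d u bu<b) (sym (T-down d v (subst (_< triangle d) (sym bv′) bv<b)))
    ...   | inj₂ bv≡b = begin
      T k d u                          ≡⟨ T-down d u bu<b ⟩
      false                            ≡⟨ sym (dec-false ((p′ + 2) % 3 ≟ (p′ + 1) % 3) p′+2≢p′+1) ⟩
      ((p′ + 2) % 3 ≡ᵇ (p′ + 1) % 3)   ≡⟨ sym (T-within-triangle-at d v b≡bv (pos≡p′ d∈D (trans b≡bv bv)) pv) ⟩
      T k d v                          ∎
      where
      open ≡-Reasoning
      b≡bv : triangle d ≡ triangle v
      b≡bv = trans (sym bv≡b) (sym bv′)

  ⌈3k/2⌉≤∣D∣ : ⌈ (3 * k) /2⌉ ≤ ∣ D ∣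
  ⌈3k/2⌉≤∣D∣ = subst₂ _≤_ (cong ⌈_/2⌉ (*-comm k 3)) (sym ∣D∣≡∑size) (⌈3k/2⌉≤∑ k size first positive pairs)
    where
    positive : ∀ i → i < k → 1 ≤ size i
    positive i i<k = n≢0⇒n>0 (triangle-nonempty i i<k)
    first : 0 < k → 2 ≤ size 0
    first 0<k = ≤∧≢⇒< (positive 0 0<k) (≢-sym (first-triangle-not-singleton 0<k))
    pairs : ∀ i → suc i < k → 3 ≤ size i + size (suc i)
    pairs i si<k with size i ≟ 1
    ... | yes size≡1 = subst (λ s → 3 ≤ s + size (suc i)) (sym size≡1)
                         (s≤s (≤∧≢⇒< (positive (suc i) si<k) (≢-sym (no-adjacent-singletons i si<k size≡1))))
    ... | no size≢1  =
      +-mono-≤ (≤∧≢⇒< (positive i (<-trans (n<1+n i) si<k)) (≢-sym size≢1)) (positive (suc i) si<k)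

even : ℕ → Bool
even zero          = true
even (suc zero)    = false
even (suc (suc n)) = even n

even-suc : ∀ n → even (suc n) ≡ not (even n)
even-suc zero          = refl
even-suc (suc zero)    = refl
even-suc (suc (suc n)) = even-suc n

odd⇒positive : ∀ {n} → even n ≡ false → 0 < n
odd⇒positive {zero}  ()
odd⇒positive {suc n} _ = z<s

chosen : ℕ → ℕ → Bool
chosen q zero          = true
chosen q (suc zero)    = even q
chosen q (suc (suc r)) = false

∑-count-chosen : ∀ k → ∑ (λ q → count (chosen q) 3) k ≡ ⌈ k * 3 /2⌉
∑-count-chosen zero          = refl
∑-count-chosen (suc zero)    = refl
∑-count-chosen (suc (suc k)) = cong (3 +_) (∑-count-chosen k)

module UpperBound (k : ℕ) where

  open Coordinates k

  D₀ : Subset (3 * k)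
  D₀ = tabulate (λ u → chosen (triangle u) (pos u))

  ∣D₀∣≡⌈3k/2⌉ : ∣ D₀ ∣ ≡ ⌈ (3 * k) /2⌉
  ∣D₀∣≡⌈3k/2⌉ = begin
    ∣ D₀ ∣                                              ≡⟨ ∣tabulate∣≡count (3 * k) chosen-at ⟩
    count chosen-at (3 * k)                             ≡⟨ cong (count chosen-at) (*-comm 3 k) ⟩
    count chosen-at (k * 3)                             ≡⟨ count-blocks k 3 chosen-at ⟩
    ∑ (λ q → count (λ r → chosen-at (q * 3 + r)) 3) k   ≡⟨ ∑-cong k (λ q → count-cong 3 (coordinates q)) ⟩
    ∑ (λ q → count (chosen q) 3) k                      ≡⟨ ∑-count-chosen k ⟩
    ⌈ k * 3 /2⌉                                         ≡⟨ cong ⌈_/2⌉ (*-comm k 3) ⟩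
    ⌈ 3 * k /2⌉                                         ∎
    where
    open ≡-Reasoning
    chosen-at : ℕ → Bool
    chosen-at a = chosen (a / 3) (a % 3)
    coordinates : ∀ q r → r < 3 → chosen-at (q * 3 + r) ≡ chosen q r
    coordinates q r r<3 = cong₂ chosen ([q*n+r]/n≡q q r<3) ([q*n+r]%n≡r q r<3)

  ∈D₀ : ∀ {u} → chosen (triangle u) (pos u) ≡ true → u ∈ D₀
  ∈D₀ {u} c = lookup⇒[]= u D₀ (trans (lookup∘tabulate _ u) c)

  insider : ∀ q → q < k → ∀ r → r < 3 → chosen q r ≡ true → ∃[ d ] (d ∈ D₀ × triangle d ≡ q × pos d ≡ r)
  insider q q<k r r<3 c = d , ∈D₀ (trans (cong₂ chosen bd pd) c) , bd , pd
    where
    d = vertex q q<k r r<3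
    bd = triangle-vertex q q<k r r<3
    pd = pos-vertex q q<k r r<3

  data Outside (u : Fin (3 * k)) : Set where
    last        : pos u ≡ 2 → Outside u
    middle-odd  : pos u ≡ 1 → even (triangle u) ≡ false → Outside u

  outside : ∀ {u} → u ∉ D₀ → Outside u
  outside {u} u∉D₀ with pos u in pu | pos<3 u
  ... | 0 | _ = contradiction (∈D₀ (cong (chosen (triangle u)) pu)) u∉D₀
  ... | 1 | _ with even (triangle u) in ev
  ...   | true  = contradiction (∈D₀ (trans (cong (chosen (triangle u)) pu) ev)) u∉D₀
  ...   | false = middle-odd pu ev
  outside {u} u∉D₀ | 2 | _ = last pu
  outside {u} u∉D₀ | suc (suc (suc _)) | s≤s (s≤s (s≤s ()))

  dominated-by : ∀ q r u → q < k → r < 3 → chosen q r ≡ true →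
                 (∀ d → triangle d ≡ q → pos d ≡ r → T k d u ≡ true) → ∃[ d ] (d ∈ D₀ × T k d u ≡ true)
  dominated-by q r u q<k r<3 c arc with insider q q<k r r<3 c
  ... | d , d∈D₀ , bd , pd = d , d∈D₀ , arc d bd pd

  distinguished-by : ∀ q r u v → q < k → r < 3 → chosen q r ≡ true →
                     (∀ d → triangle d ≡ q → pos d ≡ r → T k d u ≡ true × T k d v ≡ false) →
                     inNbrsIn (T k) D₀ u ≢ inNbrsIn (T k) D₀ v
  distinguished-by q r u v q<k r<3 c arcs with insider q q<k r r<3 c
  ... | d , d∈D₀ , bd , pd =
    inNbrsIn-separates (T k) D₀ {u} {v} d∈D₀ (proj₁ (arcs d bd pd)) (proj₂ (arcs d bd pd))

  dominating : IsDominating (T k) D₀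
  dominating u u∉D₀ with outside u∉D₀
  ... | middle-odd pu _ =
    dominated-by (triangle u) 0 u (triangle<k u) z<s refl λ d bd pd → T-within-triangle-at d u bd pd pu
  ... | last pu with even (triangle u) in ev
  ...   | true  =
    dominated-by (triangle u) 1 u (triangle<k u) (s<s z<s) ev λ d bd pd → T-within-triangle-at d u bd pd pu
  ...   | false =
    dominated-by 0 0 u (≤-<-trans z≤n (triangle<k u)) z<s refl
      λ d bd pd → T-up d u (subst (_< triangle u) (sym bd) (odd⇒positive ev))

  middle≢last : ∀ u v → pos u ≡ 1 → pos v ≡ 2 → triangle u ≡ triangle v →
                inNbrsIn (T k) D₀ u ≢ inNbrsIn (T k) D₀ v
  middle≢last u v pu pv b≡ =
    distinguished-by (triangle u) 0 u v (triangle<k u) z<s refl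
      λ d bd pd → T-within-triangle-at d u bd pd pu , T-within-triangle-at d v (trans bd b≡) pd pv

  last-in-even-triangle : ∀ {u} → Outside u → even (triangle u) ≡ true → pos u ≡ 2
  last-in-even-triangle (last pu)         _    = pu
  last-in-even-triangle (middle-odd _ odd) even = contradiction (trans (sym odd) even) λ ()

  separated : ∀ {u v} → Outside u → Outside v → triangle u ≤ triangle v → u ≢ v →
              inNbrsIn (T k) D₀ u ≢ inNbrsIn (T k) D₀ v
  separated {u} {v} (last pu) ov bu≤bv u≢v with m≤n⇒m<n∨m≡n bu≤bv | ov
  ... | inj₁ bu<bv | _ =
    ≢-sym (distinguished-by (triangle u) 0 v u (triangle<k u) z<s refl
      λ d bd pd → T-up d v (subst (_< triangle v) (sym bd) bu<bv) , T-within-triangle-at d u bd pd pu)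
  ... | inj₂ bu≡bv | middle-odd pv _ = ≢-sym (middle≢last v u pv pu (sym bu≡bv))
  ... | inj₂ bu≡bv | last pv         = contradiction (coordinates-injective bu≡bv (trans pu (sym pv))) u≢v
  separated {u} {v} (middle-odd pu odd) ov bu≤bv u≢v with m≤n⇒m<n∨m≡n bu≤bv | ov
  ... | inj₂ bu≡bv | last pv         = middle≢last u v pu pv bu≡bv
  ... | inj₂ bu≡bv | middle-odd pv _ = contradiction (coordinates-injective bu≡bv (trans pu (sym pv))) u≢v
  ... | inj₁ bu<bv | ov with m≤n⇒m<n∨m≡n bu<bv
  ...   | inj₁ 1+bu<bv =
    ≢-sym (distinguished-by (suc (triangle u)) 0 v u (<-trans 1+bu<bv (triangle<k v)) z<s refl
      λ d bd pd → T-up d v (subst (_< triangle v) (sym bd) 1+bu<bv)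
                , T-down d u (subst (triangle u <_) (sym bd) (n<1+n _)))
  ...   | inj₂ 1+bu≡bv =
    ≢-sym (distinguished-by (triangle v) 1 v u (triangle<k v) (s<s z<s) even-bv
      λ d bd pd → T-within-triangle-at d v bd pd (last-in-even-triangle ov even-bv)
                , T-down d u (subst (triangle u <_) (sym bd) bu<bv))
    where
    even-bv : even (triangle v) ≡ true
    even-bv = subst (λ n → even n ≡ true) 1+bu≡bv (trans (even-suc (triangle u)) (cong not odd))

  locating : ∀ u v → u ∉ D₀ → v ∉ D₀ → u ≢ v → inNbrsIn (T k) D₀ u ≢ inNbrsIn (T k) D₀ v
  locating u v u∉D₀ v∉D₀ u≢v with ≤-total (triangle u) (triangle v)
  ... | inj₁ bu≤bv = separated (outside u∉D₀) (outside v∉D₀) bu≤bv u≢v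
  ... | inj₂ bv≤bu = ≢-sym (separated (outside v∉D₀) (outside u∉D₀) bv≤bu (≢-sym u≢v))

proposition14 : (k : ℕ) → 1 ≤ k → LocDomNumberIs (T k) ⌈ (3 * k) /2⌉
proposition14 k _ =
  (D₀ , (dominating , locating) , ∣D₀∣≡⌈3k/2⌉) , λ D D-ld → LowerBound.⌈3k/2⌉≤∣D∣ k D D-ld
  where open UpperBound k
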